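{- In intensional Martin-Löf type theory (no truncation assumed), let $X:\mathcal U$ and $\mathrm{Pop}(X):\equiv\prod_{f:X\to X}\Big(\big(\prod_{x,y:X}f(x)=f(y)\big)\to\sum_{x:X}x=f(x)\Big)$. If $X$ has a constant endomap (an element of $\sum_{f:X\to X}\prod_{x,y:X}f(x)=f(y)$), then there is a function $\mathrm{Pop}(X)\to X$. Assuming function extensionality, conversely a function $\mathrm{Pop}(X)\to X$ yields a constant endomap on $X$. If $X$ is a proposition (i.e. $\prod_{x,y:X}x=y$), then both $\sum_{f:X\to X}\prod_{x,y:X}f(x)=f(y)$ and $\mathrm{Pop}(X)\to X$ are inhabited, without function extensionality.
   Context: Intensional Martin-Löf type theory with a universe $\mathcal U$, $\Sigma$, $\Pi$, $+$ and identity types (J only; no UIP/K). Function extensionality: for $f,g:\prod_{x:X}B(x)$, $(\prod_{x}f(x)=g(x))\to f=g$. -}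

module Defs where

open import Level using (Level; _⊔_; suc)
open import Data.Product using (Σ; _×_)
open import Relation.Binary.PropositionalEquality using (_≡_)

const : ∀ {ℓ} {X : Set ℓ} → (X → X) → Set ℓ
const {X = X} f = (x y : X) → f x ≡ f y

hasConst : ∀ {ℓ} → Set ℓ → Set ℓ
hasConst X = Σ (X → X) const

Pop : ∀ {ℓ} → Set ℓ → Set ℓ
Pop X = (f : X → X) → const f → Σ X (λ x → x ≡ f x)

isProp : ∀ {ℓ} → Set ℓ → Set ℓ
isProp X = (x y : X) → x ≡ y

FunExt : (a b : Level) → Set (Level.suc (a ⊔ b))
FunExt a b = {A : Set a} {B : A → Set b} (f g : (x : A) → B x)
             → ((x : A) → f x ≡ g x) → f ≡ g

-- The fixed points of a weakly constant endomap f form a proposition: any path s : x ≡ y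
-- is sent by cong f to c x x ⁻¹ · c x y, independently of s, so given fixed points p, q
-- the path s := p · c x x ⁻¹ · c x y · q ⁻¹ transports p to q.  Hence each x : X gives
-- an element of Pop X (the fixed point f x of f), and under function extensionality
-- Pop X is a proposition, so composing with any h : Pop X → X is weakly constant.
module Submission where

open import Defs
open import Data.Product using (Σ; _×_; _,_; proj₁)
open import Function using (id)
open import Relation.Binary.PropositionalEquality
  using (_≡_; refl; sym; trans; cong)
open import Relation.Binary.PropositionalEquality.Properties
  using (trans-reflʳ; trans-symˡ)

Fix : ∀ {ℓ} {X : Set ℓ} → (X → X) → Set ℓ
Fix {X = X} f = Σ X (λ x → x ≡ f x)

module _ {ℓ} {X : Set ℓ} {f : X → X} (c : const f) where

  cong-const : ∀ {x y} (s : x ≡ y) → cong f s ≡ trans (sym (c x x)) (c x y)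
  cong-const {x} refl = sym (trans-symˡ (c x x))

  private
    Fix-≡ : ∀ {x y} (s : x ≡ y) (p : x ≡ f x) (q : y ≡ f y)
          → trans p (cong f s) ≡ trans s q → (x , p) ≡ (y , q)
    Fix-≡ refl p q e = cong (_ ,_) (trans (sym (trans-reflʳ p)) e)

    trans-cancel : ∀ {a b d e : X} (p : a ≡ b) (r : b ≡ d) (q : e ≡ d)
                 → trans p r ≡ trans (trans p (trans r (sym q))) q
    trans-cancel refl refl refl = refl

  Fix-isProp : isProp (Fix f)
  Fix-isProp (x , p) (y , q) =
    Fix-≡ s p q (trans (cong (trans p) (cong-const s)) (trans-cancel p r q))
    where
    r : f x ≡ f y
    r = trans (sym (c x x)) (c x y)
    s : x ≡ y
    s = trans p (trans r (sym q))

Pop-isProp : ∀ {ℓ} {X : Set ℓ} → FunExt ℓ ℓ → isProp (Pop X)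
Pop-isProp fe u v =
  fe u v (λ f → fe (u f) (v f) (λ c → Fix-isProp c (u f c) (v f c)))

point-Pop : ∀ {ℓ} {X : Set ℓ} → X → Pop X
point-Pop x f c = f x , c x (f x)

hasConst⇒Pop⇒X : ∀ {ℓ} {X : Set ℓ} → hasConst X → Pop X → X
hasConst⇒Pop⇒X (f , c) pop = proj₁ (pop f c)

Pop⇒X⇒hasConst : ∀ {ℓ} {X : Set ℓ} → FunExt ℓ ℓ → (Pop X → X) → hasConst X
Pop⇒X⇒hasConst fe h =
  (λ x → h (point-Pop x)) , λ x y → cong h (Pop-isProp fe (point-Pop x) (point-Pop y))

isProp⇒hasConst : ∀ {ℓ} {X : Set ℓ} → isProp X → hasConst X
isProp⇒hasConst pr = id , pr

theorem6p6 : ∀ {ℓ} (X : Set ℓ)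
    → (hasConst X → (Pop X → X))
    × (FunExt ℓ ℓ → (Pop X → X) → hasConst X)
    × (isProp X → hasConst X × (Pop X → X))
theorem6p6 X =
    hasConst⇒Pop⇒X
  , Pop⇒X⇒hasConst
  , λ pr → isProp⇒hasConst pr , hasConst⇒Pop⇒X (isProp⇒hasConst pr)
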